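{- Let $n\geq 5$. If $G$ is a graph on $n$ vertices such that both $G$ and $\overline{G}$ are connected, then $rvc(G)+rvc(\overline{G})\geq 2$. Moreover, this lower bound is best possible: for every $n\geq 5$ there exists a graph $G$ on $n$ vertices such that $G$ and $\overline{G}$ are both connected and $rvc(G)=rvc(\overline{G})=1$.
   Context: All graphs are finite, simple and undirected. A vertex-coloring of a graph (not necessarily proper) makes the graph rainbow vertex-connected if every pair of distinct vertices is joined by a path whose internal vertices have pairwise distinct colors. For a connected graph $G$, the rainbow vertex-connection number $rvc(G)$ is the minimum number of colors in a vertex-coloring making $G$ rainbow vertex-connected (so $rvc(G)=0$ exactly when $G$ is complete). $\overline{G}$ denotes the complement of $G$. -}

module Defs where

open import Data.Bool using (Bool; true; false; not; if_then_else_)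
open import Data.Nat using (ℕ; _<_; _≤_)
open import Data.Fin using (Fin; _≟_)
open import Data.List using (List; []; _∷_; _++_; map)
open import Data.List.Relation.Unary.All using (All)
open import Data.List.Relation.Unary.Unique.Propositional using (Unique)
open import Data.Product using (Σ; _×_; ∃; ∃-syntax)
open import Relation.Binary.PropositionalEquality using (_≡_; _≢_; refl; sym)
open import Relation.Nullary using (¬_; yes; no)

record Graph (n : ℕ) : Set where
  field
    adj    : Fin n → Fin n → Bool
    adj-sym : ∀ u v → adj u v ≡ adj v u
    adj-irr : ∀ v → adj v v ≡ false
open Graph public

complement : ∀ {n} → Graph n → Graph n
complement {n} G = record { adj = cadj ; adj-sym = csym ; adj-irr = cirr }
  where
  cadj : Fin n → Fin n → Bool
  cadj u v with u ≟ v
  ... | yes _ = false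
  ... | no  _ = not (adj G u v)
  csym : ∀ u v → cadj u v ≡ cadj v u
  csym u v with u ≟ v | v ≟ u
  ... | yes _ | yes _ = refl
  ... | yes p | no ¬q = Data.Empty.⊥-elim (¬q (sym p))
    where import Data.Empty
  ... | no ¬p | yes q = Data.Empty.⊥-elim (¬p (sym q))
    where import Data.Empty
  ... | no _  | no _  rewrite adj-sym G u v = refl
  cirr : ∀ v → cadj v v ≡ false
  cirr v with v ≟ v
  ... | yes _ = refl
  ... | no ¬p = Data.Empty.⊥-elim (¬p refl)
    where import Data.Empty

-- Walk G u v is : a walk u, w₁, …, w_k, v in G whose list of internal
-- vertices is  is = w₁ ∷ … ∷ w_k ∷ [].
data Walk {n : ℕ} (G : Graph n) : Fin n → Fin n → List (Fin n) → Set where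
  edge : ∀ {u v} → adj G u v ≡ true → Walk G u v []
  step : ∀ {u w v is} → adj G u w ≡ true → Walk G w v is → Walk G u v (w ∷ is)

IsPath : ∀ {n} → Graph n → Fin n → Fin n → List (Fin n) → Set
IsPath G u v is = Walk G u v is × Unique (u ∷ is ++ v ∷ [])

Connected : ∀ {n} → Graph n → Set
Connected {n} G = ∀ (u v : Fin n) → u ≢ v → ∃[ is ] IsPath G u v is

-- A vertex-colouring with (at most) k colours, colours being 0,…,k-1.
-- Only the colours of internal vertices of the chosen paths are constrained to
-- lie below k; this realises the convention rvc(G) = 0 iff G is complete.
RainbowInternal : ∀ {n} → (Fin n → ℕ) → ℕ → List (Fin n) → Set
RainbowInternal c k is = All (λ w → c w < k) is × Unique (map c is)

RainbowVertexConnected : ∀ {n} → Graph n → (Fin n → ℕ) → ℕ → Set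
RainbowVertexConnected {n} G c k =
  ∀ (u v : Fin n) → u ≢ v → ∃[ is ] (IsPath G u v is × RainbowInternal c k is)

RVCColourable : ∀ {n} → Graph n → ℕ → Set
RVCColourable {n} G k = ∃[ c ] RainbowVertexConnected G c k

IsRVC : ∀ {n} → Graph n → ℕ → Set
IsRVC G k = RVCColourable G k × (∀ j → j < k → ¬ RVCColourable G j)

-- rvc(G) = 0 forces G to be complete, so its complement has no edges and is
-- not connected; hence rvc(G) and rvc(complement G) are both at least 1.  For
-- sharpness, blow up one vertex of the pentagon into an independent set: the
-- result and its complement are both incomplete and of diameter 2, and a single
-- colour makes a graph of diameter 2 rainbow vertex-connected.
module Submission where

open import Defs
open import Data.Nat using (ℕ; zero; suc; _≤_; _+_; s≤s; z≤n)
open import Data.Nat.Properties using (+-mono-≤)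
open import Data.Bool using (true; false; not; _∨_)
import Data.Bool.Properties as Bool
open import Data.Fin using (Fin; zero; suc; _≟_; _↑ˡ_)
open import Data.Fin.Properties using (all?; any?)
open import Data.List using ([]; _∷_)
open import Data.List.Relation.Unary.All using ([]; _∷_)
open import Data.List.Relation.Unary.AllPairs using ([]; _∷_)
open import Data.Product using (_×_; Σ; ∃; _,_)
open import Data.Sum using (_⊎_; inj₁; inj₂)
open import Data.Empty using (⊥; ⊥-elim)
open import Relation.Nullary using (¬_; Dec; yes; no; ¬?)
open import Relation.Nullary.Decidable using (⌊_⌋; from-yes; _⊎-dec_; _×-dec_; _→-dec_)
open import Relation.Binary.PropositionalEquality using (_≡_; _≢_; refl; sym; trans; cong; subst)

module _ {n : ℕ} where

  Complete : Graph n → Set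
  Complete H = ∀ u v → u ≢ v → adj H u v ≡ true

  Reach2 : Graph n → Fin n → Fin n → Set
  Reach2 H u v = adj H u v ≡ true ⊎ ∃ λ w → adj H u w ≡ true × adj H w v ≡ true

  Diam2 : Graph n → Set
  Diam2 H = ∀ u v → u ≢ v → Reach2 H u v

  reach2? : (H : Graph n) → ∀ u v → Dec (Reach2 H u v)
  reach2? H u v = (adj H u v Bool.≟ true)
    ⊎-dec any? (λ w → (adj H u w Bool.≟ true) ×-dec (adj H w v Bool.≟ true))

  diam2? : (H : Graph n) → Dec (Diam2 H)
  diam2? H = all? λ u → all? λ v → ¬? (u ≟ v) →-dec reach2? H u v

  adj⇒≢ : (H : Graph n) → ∀ {u v} → adj H u v ≡ true → u ≢ v
  adj⇒≢ H {u} e refl with () ← trans (sym e) (adj-irr H u)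

  complement-adj : (G : Graph n) → ∀ {u v} → u ≢ v → adj (complement G) u v ≡ not (adj G u v)
  complement-adj G {u} {v} u≢v with u ≟ v
  ... | yes u≡v = ⊥-elim (u≢v u≡v)
  ... | no _    = refl

  complement-adj-true : (G : Graph n) → ∀ {u v} → u ≢ v → adj G u v ≡ false →
                        adj (complement G) u v ≡ true
  complement-adj-true G u≢v e rewrite complement-adj G u≢v | e = refl

  complement-adj-true⁻ : (G : Graph n) → ∀ {u v} → adj (complement G) u v ≡ true →
                         adj G u v ≡ false
  complement-adj-true⁻ G {u} {v} e with adj G u v in eq
  ... | false = refl
  ... | true  with () ← trans (sym e)
    (trans (complement-adj G (adj⇒≢ (complement G) e)) (cong not eq))

  EdgeDisjoint : Graph n → Graph n → Set
  EdgeDisjoint H K = ∀ {u v} → adj H u v ≡ true → adj K u v ≡ true → ⊥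

  edgeDisjoint-complement : (G : Graph n) → EdgeDisjoint G (complement G)
  edgeDisjoint-complement G e e′ with () ← trans (sym e) (complement-adj-true⁻ G e′)

  edgeDisjoint-sym : ∀ {H K} → EdgeDisjoint H K → EdgeDisjoint K H
  edgeDisjoint-sym d e e′ = d e′ e

  rvc0⇒complete : (H : Graph n) → RVCColourable H 0 → Complete H
  rvc0⇒complete H (c , rvc) u v u≢v with rvc u v u≢v
  ... | [] , (edge e , _) , _ = e
  ... | _ ∷ _ , _ , (() ∷ _ , _)

  rvc⇒connected : (H : Graph n) → ∀ c k → RainbowVertexConnected H c k → Connected H
  rvc⇒connected H c k rvc u v u≢v with rvc u v u≢v
  ... | is , path , _ = is , path

  -- One colour suffices: a path with at most one internal vertex is rainbow.
  diam2⇒rvc : (H : Graph n) → Diam2 H → RainbowVertexConnected H (λ _ → 0) 1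
  diam2⇒rvc H d u v u≢v with d u v u≢v
  ... | inj₁ e = [] , (edge e , (u≢v ∷ []) ∷ [] ∷ []) , ([] , [])
  ... | inj₂ (w , e₁ , e₂) =
    w ∷ [] , (step e₁ (edge e₂) , (adj⇒≢ H e₁ ∷ u≢v ∷ []) ∷ (adj⇒≢ H e₂ ∷ []) ∷ [] ∷ [])
           , (s≤s z≤n ∷ [] , [] ∷ [])

  nonedge⇒¬complete : (H : Graph n) → ∀ {u v} → u ≢ v → adj H u v ≡ false → ¬ Complete H
  nonedge⇒¬complete H {u} {v} u≢v e complete with () ← trans (sym (complete u v u≢v)) e

  diam2⇒isRVC1 : (H : Graph n) → Diam2 H → ¬ Complete H → IsRVC H 1
  diam2⇒isRVC1 H d ¬complete =
    (_ , diam2⇒rvc H d) , λ { zero (s≤s z≤n) r → ¬complete (rvc0⇒complete H r) }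

complete⇒¬connected-disjoint : ∀ {n} (H K : Graph (suc (suc n))) →
  Complete H → EdgeDisjoint H K → ¬ Connected K
complete⇒¬connected-disjoint H K complete disjoint connected
  with connected zero (suc zero) (λ ())
... | _ , edge e , _   = disjoint (complete _ _ (adj⇒≢ K e)) e
... | _ , step e _ , _ = disjoint (complete _ _ (adj⇒≢ K e)) e

isRVC-positive : ∀ {n} (H K : Graph (suc (suc n))) → EdgeDisjoint H K → Connected K →
                 ∀ k → IsRVC H k → 1 ≤ k
isRVC-positive H K disjoint connected zero (r , _) =
  ⊥-elim (complete⇒¬connected-disjoint H K (rvc0⇒complete H r) disjoint connected)
isRVC-positive H K disjoint connected (suc k) _ = s≤s z≤n

-- Collapsing Fin (suc k + m) onto Fin (suc k): the last m + 1 vertices all go to k.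
collapse : ∀ {k} m → Fin (suc k + m) → Fin (suc k)
collapse {zero}  m _       = zero
collapse {suc k} m zero    = zero
collapse {suc k} m (suc i) = suc (collapse m i)

collapse-↑ˡ : ∀ {k} m (i : Fin (suc k)) → collapse m (i ↑ˡ m) ≡ i
collapse-↑ˡ {zero}  m zero    = refl
collapse-↑ˡ {suc k} m zero    = refl
collapse-↑ˡ {suc k} m (suc i) = cong suc (collapse-↑ˡ m i)

module _ {k : ℕ} (m : ℕ) (H : Graph (suc k)) where

  blowup : Graph (suc k + m)
  blowup = record
    { adj     = λ u v → adj H (collapse m u) (collapse m v)
    ; adj-sym = λ u v → adj-sym H (collapse m u) (collapse m v)
    ; adj-irr = λ v → adj-irr H (collapse m v)
    }

  blowup-diam2 : (∀ a b → Reach2 H a b) → Diam2 blowup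
  blowup-diam2 reach u v _ with reach (collapse m u) (collapse m v)
  ... | inj₁ e = inj₁ e
  ... | inj₂ (c , e₁ , e₂) = inj₂ (c ↑ˡ m ,
    subst (λ x → adj H (collapse m u) x ≡ true) (sym (collapse-↑ˡ m c)) e₁ ,
    subst (λ x → adj H x (collapse m v) ≡ true) (sym (collapse-↑ˡ m c)) e₂)

  complement-edge-lift : ∀ {u v} → adj (complement H) (collapse m u) (collapse m v) ≡ true →
                         adj (complement blowup) u v ≡ true
  complement-edge-lift e = complement-adj-true blowup
    (λ u≡v → adj⇒≢ (complement H) e (cong (collapse m) u≡v)) (complement-adj-true⁻ H e)

  -- Vertices of one class are adjacent in the complement of the blow-up, so only
  -- distinct classes need the diameter-2 property of the complement of H.
  blowup-complement-diam2 : Diam2 (complement H) → Diam2 (complement blowup)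
  blowup-complement-diam2 d u v u≢v with collapse m u ≟ collapse m v
  ... | yes same = inj₁ (complement-adj-true blowup u≢v
          (subst (λ x → adj H (collapse m u) x ≡ false) same (adj-irr H _)))
  ... | no differ with d _ _ differ
  ...   | inj₁ e = inj₁ (complement-edge-lift e)
  ...   | inj₂ (c , e₁ , e₂) = inj₂ (c ↑ˡ m ,
    complement-edge-lift (subst (λ x → adj (complement H) (collapse m u) x ≡ true) (sym (collapse-↑ˡ m c)) e₁) ,
    complement-edge-lift (subst (λ x → adj (complement H) x (collapse m v) ≡ true) (sym (collapse-↑ˡ m c)) e₂))

next : Fin 5 → Fin 5
next zero                      = suc zero
next (suc zero)                = suc (suc zero)
next (suc (suc zero))          = suc (suc (suc zero))
next (suc (suc (suc zero)))    = suc (suc (suc (suc zero)))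
next (suc (suc (suc (suc _)))) = zero

pentagon : Graph 5
pentagon = record
  { adj     = λ a b → ⌊ b ≟ next a ⌋ ∨ ⌊ a ≟ next b ⌋
  ; adj-sym = λ a b → Bool.∨-comm ⌊ b ≟ next a ⌋ ⌊ a ≟ next b ⌋
  ; adj-irr = from-yes (all? λ a → (⌊ a ≟ next a ⌋ ∨ ⌊ a ≟ next a ⌋) Bool.≟ false)
  }

pentagon-reach2 : ∀ a b → Reach2 pentagon a b
pentagon-reach2 = from-yes (all? λ a → all? λ b → reach2? pentagon a b)

pentagon-complement-diam2 : Diam2 (complement pentagon)
pentagon-complement-diam2 = from-yes (diam2? (complement pentagon))

theorem3p1 : (∀ (n : ℕ) → 5 ≤ n → (G : Graph n) → Connected G → Connected (complement G) →
    ∀ (k₁ k₂ : ℕ) → IsRVC G k₁ → IsRVC (complement G) k₂ → 2 ≤ k₁ + k₂)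
    × (∀ (n : ℕ) → 5 ≤ n → Σ (Graph n) λ G → (Connected G × Connected (complement G) ×
    IsRVC G 1 × IsRVC (complement G) 1))
theorem3p1 = lower-bound , sharpness
  where
  lower-bound : ∀ (n : ℕ) → 5 ≤ n → (G : Graph n) → Connected G → Connected (complement G) →
                ∀ (k₁ k₂ : ℕ) → IsRVC G k₁ → IsRVC (complement G) k₂ → 2 ≤ k₁ + k₂
  lower-bound (suc (suc n)) (s≤s (s≤s _)) G connected connected′ k₁ k₂ rvc rvc′ = +-mono-≤
    (isRVC-positive G (complement G) (edgeDisjoint-complement G) connected′ k₁ rvc)
    (isRVC-positive (complement G) G (edgeDisjoint-sym {H = G} {K = complement G} (edgeDisjoint-complement G)) connected k₂ rvc′)

  sharpness : ∀ (n : ℕ) → 5 ≤ n → Σ (Graph n) λ G → (Connected G × Connected (complement G) ×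
              IsRVC G 1 × IsRVC (complement G) 1)
  sharpness (suc (suc (suc (suc (suc m))))) (s≤s (s≤s (s≤s (s≤s (s≤s _))))) =
    G , rvc⇒connected G _ _ (diam2⇒rvc G d) , rvc⇒connected G′ _ _ (diam2⇒rvc G′ d′)
      , diam2⇒isRVC1 G d (nonedge⇒¬complete G {zero} {suc (suc zero)} (λ ()) refl)
      , diam2⇒isRVC1 G′ d′ (nonedge⇒¬complete G′ {zero} {suc zero} (λ ()) refl)
    where
    G G′ : Graph (5 + m)
    G  = blowup m pentagon
    G′ = complement G
    d  = blowup-diam2 m pentagon pentagon-reach2
    d′ = blowup-complement-diam2 m pentagon pentagon-complement-diam2
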